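{- Let $\mathbf{R}$ be a commutative ring containing $\mathbb{Q}$ and let $\mathcal{TR}$ be the triple Riordan group (defined in the context). Then each of the following subsets is a subgroup of $\mathcal{TR}$: $\mathcal{A}=\{(1,f_1,f_2,f_3)\}$, $\mathcal{B}_1=\{(g,xg,f_2,f_3)\}$, $\mathcal{B}_2=\{(g,f_1,xg,f_3)\}$, $\mathcal{B}_3=\{(g,f_1,f_2,xg)\}$, where in each case $g$ ranges over $\mathbf{R}[[x^3]]$ with $g_0=1$ and the $f_i$ range over $x\mathbf{R}[[x^3]]$ with $(f_i)_1=1$.
   Context: $\mathcal{TR}$ is the set of $4$-tuples $(g,f_1,f_2,f_3)$ with $g\in\mathbf{R}[[x^3]]$, $g_0=1$, $f_i\in x\mathbf{R}[[x^3]]$, $(f_i)_1=1$ ($g_0$ the constant coefficient, $(f_i)_1$ the coefficient of $x$), with product $(g,f_1,f_2,f_3)\cdot(G,F_1,F_2,F_3)=\left(gG(h),\frac{f_1}{h}F_1(h),\frac{f_2}{h}F_2(h),\frac{f_3}{h}F_3(h)\right)$ where $h=(f_1f_2f_3)^{1/3}$ is the series $x+\cdots$ whose cube is $f_1f_2f_3$. It is a group with identity $(1,x,x,x)$. -}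

module Defs where

open import Level using (_⊔_)
open import Algebra.Bundles using (CommutativeRing)
open import Data.Nat using (ℕ; zero; suc; _∸_; _%_)
open import Data.List using (List; []; _∷_; _++_; [_])
open import Data.Product using (Σ; _×_; _,_)
open import Relation.Binary.PropositionalEquality using (_≢_)

module RingNat {c ℓ} (R : CommutativeRing c ℓ) where
  open CommutativeRing R
  natR : ℕ → Carrier
  natR zero    = 0#
  natR (suc n) = 1# + natR n

-- "R contains ℚ": every positive integer is invertible in R
-- (recip n is the inverse of n+1), i.e. R is a ℚ-algebra.
record Containsℚ {c ℓ} (R : CommutativeRing c ℓ) : Set (c ⊔ ℓ) where
  open CommutativeRing R
  open RingNat R
  field
    recip     : ℕ → Carrier
    recip-inv : ∀ n → natR (suc n) * recip n ≈ 1#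

module TripleRiordan {c ℓ} (R : CommutativeRing c ℓ) (Q : Containsℚ R) where
  open CommutativeRing R
  open Containsℚ Q

  Series : Set c
  Series = ℕ → Carrier

  _≋_ : Series → Series → Set ℓ
  f ≋ g = ∀ n → f n ≈ g n

  sumTo : (ℕ → Carrier) → ℕ → Carrier
  sumTo f zero    = 0#
  sumTo f (suc n) = sumTo f n + f n

  _⊛_ : Series → Series → Series
  (a ⊛ b) n = sumTo (λ k → a k * b (n ∸ k)) (suc n)

  one : Series
  one zero    = 1#
  one (suc n) = 0#

  pow : Series → ℕ → Series
  pow a zero    = one
  pow a (suc k) = a ⊛ pow a k

  -- composition G(h), for h with zero constant term
  compose : Series → Series → Series
  compose G h n = sumTo (λ k → G k * pow h k n) (suc n)

  X· : Series → Series
  X· a zero    = 0#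
  X· a (suc n) = a n

  xS : Series
  xS = X· one

  -- division by x (for series with zero constant term)
  ÷X : Series → Series
  ÷X a n = a (suc n)

  -- series defined by course-of-values recursion on the coefficients:
  -- coefficient n = step n b, where b k is coefficient k for k < n and 0 otherwise
  idx : List Carrier → ℕ → Carrier
  idx []       n       = 0#
  idx (x ∷ xs) zero    = x
  idx (x ∷ xs) (suc n) = idx xs n

  prefix : (ℕ → (ℕ → Carrier) → Carrier) → ℕ → List Carrier
  prefix step zero    = []
  prefix step (suc n) = prefix step n ++ [ step n (idx (prefix step n)) ]

  recS : (ℕ → (ℕ → Carrier) → Carrier) → Series
  recS step n = step n (idx (prefix step n))

  -- multiplicative inverse of a series with constant term 1
  inv1 : Series → Series
  inv1 a = recS step
    where
    step : ℕ → (ℕ → Carrier) → Carrier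
    step zero    b = 1#
    step (suc n) b = - sumTo (λ k → a (suc k) * b (n ∸ k)) (suc n)

  third : Carrier
  third = recip 2

  -- the cube root u (with u₀ = 1) of a series w with constant term 1:
  -- u_n = (w_n - [x^n] (u with u_n := 0)^3) / 3
  cbrt1 : Series → Series
  cbrt1 w = recS step
    where
    step : ℕ → (ℕ → Carrier) → Carrier
    step zero    u = 1#
    step (suc n) u = third * (w (suc n) - pow u 3 (suc n))

  record Quad : Set c where
    constructor ⟨_,_,_,_⟩
    field
      g f₁ f₂ f₃ : Series
  open Quad public

  _≈Q_ : Quad → Quad → Set ℓ
  a ≈Q b = (g a ≋ g b) × (f₁ a ≋ f₁ b) × (f₂ a ≋ f₂ b) × (f₃ a ≋ f₃ b)

  -- h = (f₁f₂f₃)^{1/3} = x + ⋯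
  cubeRootSeries : Series → Series → Series → Series
  cubeRootSeries p q r = X· (cbrt1 (÷X (÷X (÷X (p ⊛ (q ⊛ r))))))

  _∙_ : Quad → Quad → Quad
  a ∙ b = ⟨ g a ⊛ compose (g b) h , q (f₁ a) (f₁ b) , q (f₂ a) (f₂ b) , q (f₃ a) (f₃ b) ⟩
    where
    h : Series
    h = cubeRootSeries (f₁ a) (f₂ a) (f₃ a)
    -- (f / h) · F(h), computed as (f/x) · (h/x)⁻¹ · F(h)
    q : Series → Series → Series
    q f F = ((÷X f) ⊛ inv1 (÷X h)) ⊛ compose F h

  e : Quad
  e = ⟨ one , xS , xS , xS ⟩

  IsG : Series → Set ℓ
  IsG s = (∀ n → n % 3 ≢ 0 → s n ≈ 0#) × s 0 ≈ 1#

  IsF : Series → Set ℓ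
  IsF s = (∀ n → n % 3 ≢ 1 → s n ≈ 0#) × s 1 ≈ 1#

  InTR : Quad → Set ℓ
  InTR a = IsG (g a) × IsF (f₁ a) × IsF (f₂ a) × IsF (f₃ a)

  -- subgroup of 𝒯ℛ (S is a predicate on 4-tuples that implies membership in 𝒯ℛ)
  IsSubgroup : (Quad → Set ℓ) → Set (c ⊔ ℓ)
  IsSubgroup S =
      S e
    × (∀ a b → S a → S b → S (a ∙ b))
    × (∀ a → S a → Σ Quad λ b → S b × (a ∙ b) ≈Q e × (b ∙ a) ≈Q e)

  𝒜 : Quad → Set ℓ
  𝒜 a = InTR a × (g a ≋ one)

  ℬ₁ : Quad → Set ℓ
  ℬ₁ a = InTR a × (f₁ a ≋ X· (g a))

  ℬ₂ : Quad → Set ℓ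
  ℬ₂ a = InTR a × (f₂ a ≋ X· (g a))

  ℬ₃ : Quad → Set ℓ
  ℬ₃ a = InTR a × (f₃ a ≋ X· (g a))

{-# OPTIONS --safe #-}
-- For h with h₀ = 0, composition F ↦ F(h) is a
-- ring homomorphism and is associative; both follow from Horner's rule F(h) = F₀ + h·(F/x)(h) by
-- induction on the coefficient index. A series h = x + ⋯ has a compositional inverse L, built one
-- coefficient at a time, and since 3 is invertible a series 1 + ⋯ has a unique cube root 1 + ⋯.
-- Write φᵢ = fᵢ/x and h = xη with η³ = φ₁φ₂φ₃. The inverse of (g, f₁, f₂, f₃) is
-- ((1/g)(L), (xη/φ₁)(L), (xη/φ₂)(L), (xη/φ₃)(L)): its f-components multiply to L³, so the
-- series h of the inverse is L, and both products with (g, f₁, f₂, f₃) collapse to (1, x, x, x).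
-- The conditions g ∈ R[[x³]] and fᵢ ∈ xR[[x³]] say that the support lies in one residue class
-- mod 3, which products, composition with h ∈ xR[[x³]], reciprocals, cube roots and compositional
-- inverses all preserve.
module Submission where

open import Defs
open import Algebra.Bundles using (CommutativeRing; CommutativeSemiring)
open import Algebra.Structures.Biased using (isCommutativeSemiringˡ; isCommutativeMonoidˡ)
import Algebra.Solver.Ring.NaturalCoefficients.Default as NaturalSolver
open import Data.Product using (_×_; _,_; proj₁; proj₂)
open import Data.List using ([]; _∷_; _++_; [_]; length)
open import Data.List.Properties using (length-++)
open import Data.Nat as ℕ using (ℕ; zero; suc; _∸_; _<_; _≤_; z≤n; s≤s; _<?_; _%_; NonZero)
  renaming (_+_ to _+ℕ_)
import Data.Nat.Properties as ℕₚ
open import Data.Nat.DivMod using (%-distribˡ-+; [m+n]%n≡m%n)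
open import Data.Nat.Induction using (<-rec)
open import Data.Sum using (inj₁; inj₂)
open import Relation.Binary.Bundles using (Setoid)
open import Relation.Binary.PropositionalEquality as ≡ using (_≡_; _≢_)
import Relation.Binary.Reasoning.Setoid as SetoidReasoning
open import Relation.Nullary using (yes; no)
open import Relation.Nullary.Negation using (contradiction)

%-cong-+ : ∀ {d} .{{_ : NonZero d}} {m m′ n n′} →
           m % d ≡ m′ % d → n % d ≡ n′ % d → (m +ℕ n) % d ≡ (m′ +ℕ n′) % d
%-cong-+ {d} {m} {m′} {n} {n′} m≡m′ n≡n′ = ≡.trans (%-distribˡ-+ m n d)
  (≡.trans (≡.cong₂ (λ i j → (i +ℕ j) % d) m≡m′ n≡n′) (≡.sym (%-distribˡ-+ m′ n′ d)))

%-cong-suc : ∀ {d} .{{_ : NonZero d}} {m n} → m % d ≡ n % d → suc m % d ≡ suc n % d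
%-cong-suc = %-cong-+ {m = 1} {m′ = 1} ≡.refl

%-cancel-suc : ∀ {d} .{{_ : NonZero d}} {m n} → suc m % d ≡ suc n % d → m % d ≡ n % d
%-cancel-suc {d} {m} {n} 1+m≡1+n = begin
  m % d                   ≡⟨ [m+n]%n≡m%n m d ⟨
  (m +ℕ d) % d            ≡⟨ ≡.cong (_% d) (shift m) ⟩
  (suc m +ℕ ℕ.pred d) % d ≡⟨ %-cong-+ 1+m≡1+n ≡.refl ⟩
  (suc n +ℕ ℕ.pred d) % d ≡⟨ ≡.cong (_% d) (shift n) ⟨
  (n +ℕ d) % d            ≡⟨ [m+n]%n≡m%n n d ⟩
  n % d                   ∎
  where
  open ≡.≡-Reasoning
  shift : ∀ k → k +ℕ d ≡ suc k +ℕ ℕ.pred d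
  shift k = ≡.trans (≡.cong (k +ℕ_) (≡.sym (ℕₚ.suc-pred d))) (ℕₚ.+-suc k (ℕ.pred d))

module TripleRiordanGroup {c ℓ} (R : CommutativeRing c ℓ) (Q : Containsℚ R) where

  open CommutativeRing R
  open RingNat R
  open Containsℚ Q
  open TripleRiordan R Q
  open import Algebra.Properties.Ring ring using (-0#≈0#)
  open import Algebra.Properties.Group +-group using (//-rightDividesˡ; //-rightDividesʳ)
  open NaturalSolver commutativeSemiring using (solve; _:=_; _:+_; _:*_; con)
  module ≈-Reasoning = SetoidReasoning setoid

  x≈0⇒x*y≈0 : ∀ {x} y → x ≈ 0# → x * y ≈ 0#
  x≈0⇒x*y≈0 y x≈0 = trans (*-cong x≈0 refl) (zeroˡ y)

  y≈0⇒x*y≈0 : ∀ x {y} → y ≈ 0# → x * y ≈ 0#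
  y≈0⇒x*y≈0 x y≈0 = trans (*-cong refl y≈0) (zeroʳ x)

  -- Finite sums

  sumTo-cong : ∀ {f g : ℕ → Carrier} n → (∀ k → k < n → f k ≈ g k) → sumTo f n ≈ sumTo g n
  sumTo-cong zero    f≈g = refl
  sumTo-cong (suc n) f≈g =
    +-cong (sumTo-cong n (λ k k<n → f≈g k (ℕₚ.m<n⇒m<1+n k<n))) (f≈g n (ℕₚ.n<1+n n))

  sumTo-zero : ∀ {f : ℕ → Carrier} n → (∀ k → k < n → f k ≈ 0#) → sumTo f n ≈ 0#
  sumTo-zero zero    f≈0 = refl
  sumTo-zero (suc n) f≈0 = trans
    (+-cong (sumTo-zero n (λ k k<n → f≈0 k (ℕₚ.m<n⇒m<1+n k<n))) (f≈0 n (ℕₚ.n<1+n n)))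
    (+-identityʳ 0#)

  sumTo-distrib-+ : ∀ (f g : ℕ → Carrier) n → sumTo (λ k → f k + g k) n ≈ sumTo f n + sumTo g n
  sumTo-distrib-+ f g zero    = sym (+-identityʳ 0#)
  sumTo-distrib-+ f g (suc n) = trans (+-cong (sumTo-distrib-+ f g n) refl) (interchange _ _ _ _)
    where
    interchange : ∀ a b c d → (a + b) + (c + d) ≈ (a + c) + (b + d)
    interchange = solve 4 (λ a b c d → (a :+ b) :+ (c :+ d) := (a :+ c) :+ (b :+ d)) refl

  *-distribˡ-sumTo : ∀ x (f : ℕ → Carrier) n → sumTo (λ k → x * f k) n ≈ x * sumTo f n
  *-distribˡ-sumTo x f zero    = sym (zeroʳ x)
  *-distribˡ-sumTo x f (suc n) = trans (+-cong (*-distribˡ-sumTo x f n) refl) (sym (distribˡ x _ _))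

  sumTo-sucˡ : ∀ (f : ℕ → Carrier) n → sumTo f (suc n) ≈ f 0 + sumTo (λ k → f (suc k)) n
  sumTo-sucˡ f zero    = trans (+-identityˡ _) (sym (+-identityʳ _))
  sumTo-sucˡ f (suc n) = trans (+-cong (sumTo-sucˡ f n) refl) (+-assoc _ _ _)

  sumTo-vanishing-tail : ∀ (f : ℕ → Carrier) {m n} → m ≤ n → (∀ k → m ≤ k → f k ≈ 0#) →
                         sumTo f n ≈ sumTo f m
  sumTo-vanishing-tail f {m} {n} m≤n f≈0 =
    ≡.subst (λ i → sumTo f i ≈ sumTo f m) (ℕₚ.m∸n+n≡m m≤n) (go (n ∸ m))
    where
    go : ∀ j → sumTo f (j +ℕ m) ≈ sumTo f m
    go zero    = refl
    go (suc j) = trans (+-cong (go j) (f≈0 (j +ℕ m) (ℕₚ.m≤n+m m j))) (+-identityʳ _)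

  -- Formal power series

  infix  4 _≋[_]_
  infixl 6 _+S_
  infixr 7 _·S_

  ≋-setoid : Setoid c ℓ
  ≋-setoid = record
    { Carrier       = Series
    ; _≈_           = _≋_
    ; isEquivalence = record
      { refl  = λ _ → refl
      ; sym   = λ a≋b n → sym (a≋b n)
      ; trans = λ a≋b b≋d n → trans (a≋b n) (b≋d n)
      }
    }

  open Setoid ≋-setoid using () renaming (refl to ≋-refl; sym to ≋-sym; trans to ≋-trans)
  module ≋-Reasoning = SetoidReasoning ≋-setoid

  _≋[_]_ : Series → ℕ → Series → Set ℓ
  a ≋[ n ] b = ∀ k → k ≤ n → a k ≈ b k

  ≋[]-suc : ∀ {a b} n → a ≋[ n ] b → a (suc n) ≈ b (suc n) → a ≋[ suc n ] b
  ≋[]-suc n a≋b eq k k≤1+n with ℕₚ.m≤n⇒m<n∨m≡n k≤1+n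
  ... | inj₁ k<1+n  = a≋b k (ℕₚ.≤-pred k<1+n)
  ... | inj₂ ≡.refl = eq

  _+S_ : Series → Series → Series
  (a +S b) n = a n + b n

  0S : Series
  0S n = 0#

  _·S_ : Carrier → Series → Series
  (x ·S a) n = x * a n

  ⊛-cong : ∀ {a a′ b b′} → a ≋ a′ → b ≋ b′ → (a ⊛ b) ≋ (a′ ⊛ b′)
  ⊛-cong a≋a′ b≋b′ n = sumTo-cong (suc n) (λ k _ → *-cong (a≋a′ k) (b≋b′ (n ∸ k)))

  ⊛-congˡ : ∀ a {b b′} → b ≋ b′ → (a ⊛ b) ≋ (a ⊛ b′)
  ⊛-congˡ a = ⊛-cong {a = a} ≋-refl

  ⊛-congʳ : ∀ b {a a′} → a ≋ a′ → (a ⊛ b) ≋ (a′ ⊛ b)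
  ⊛-congʳ b a≋a′ = ⊛-cong {b = b} a≋a′ ≋-refl

  ⊛-cong-upTo : ∀ {a a′ b b′} n → a ≋[ n ] a′ → b ≋[ n ] b′ → (a ⊛ b) n ≈ (a′ ⊛ b′) n
  ⊛-cong-upTo n a≋a′ b≋b′ = sumTo-cong (suc n) (λ k k<1+n →
    *-cong (a≋a′ k (ℕₚ.≤-pred k<1+n)) (b≋b′ (n ∸ k) (ℕₚ.m∸n≤m n k)))

  ⊛-coeff-zero : ∀ a b → (a ⊛ b) 0 ≈ a 0 * b 0
  ⊛-coeff-zero a b = +-identityˡ _

  ⊛-coeff-sucˡ : ∀ a b n → (a ⊛ b) (suc n) ≈ a 0 * b (suc n) + (÷X a ⊛ b) n
  ⊛-coeff-sucˡ a b n = sumTo-sucˡ (λ k → a k * b (suc n ∸ k)) (suc n)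

  ⊛-coeff-sucʳ : ∀ a b n → (a ⊛ b) (suc n) ≈ (a ⊛ ÷X b) n + a (suc n) * b 0
  ⊛-coeff-sucʳ a b n = +-cong
    (sumTo-cong (suc n) (λ k k<1+n →
      reflexive (≡.cong (λ i → a k * b i) (ℕₚ.+-∸-assoc 1 (ℕₚ.≤-pred k<1+n)))))
    (reflexive (≡.cong (λ i → a (suc n) * b i) (ℕₚ.n∸n≡0 n)))

  ⊛-comm : ∀ a b → (a ⊛ b) ≋ (b ⊛ a)
  ⊛-comm a b zero    = trans (⊛-coeff-zero a b) (trans (*-comm _ _) (sym (⊛-coeff-zero b a)))
  ⊛-comm a b (suc n) = begin
    (a ⊛ b) (suc n)                ≈⟨ ⊛-coeff-sucˡ a b n ⟩
    a 0 * b (suc n) + (÷X a ⊛ b) n ≈⟨ +-cong (*-comm _ _) (⊛-comm (÷X a) b n) ⟩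
    b (suc n) * a 0 + (b ⊛ ÷X a) n ≈⟨ +-comm _ _ ⟩
    (b ⊛ ÷X a) n + b (suc n) * a 0 ≈⟨ ⊛-coeff-sucʳ b a n ⟨
    (b ⊛ a) (suc n)                ∎
    where open ≈-Reasoning

  ⊛-distribʳ : ∀ d a b → ((a +S b) ⊛ d) ≋ (a ⊛ d +S b ⊛ d)
  ⊛-distribʳ d a b n =
    trans (sumTo-cong (suc n) (λ k _ → distribʳ _ _ _)) (sumTo-distrib-+ _ _ (suc n))

  ·S-⊛ : ∀ x a b → ((x ·S a) ⊛ b) ≋ (x ·S (a ⊛ b))
  ·S-⊛ x a b n = trans (sumTo-cong (suc n) (λ k _ → *-assoc _ _ _)) (*-distribˡ-sumTo x _ (suc n))

  ÷X-⊛ : ∀ a b → ÷X (a ⊛ b) ≋ (a 0 ·S ÷X b +S ÷X a ⊛ b)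
  ÷X-⊛ a b = ⊛-coeff-sucˡ a b

  ⊛-assoc : ∀ a b d → ((a ⊛ b) ⊛ d) ≋ (a ⊛ (b ⊛ d))
  ⊛-assoc a b d zero = begin
    ((a ⊛ b) ⊛ d) 0   ≈⟨ trans (⊛-coeff-zero (a ⊛ b) d) (*-cong (⊛-coeff-zero a b) refl) ⟩
    (a 0 * b 0) * d 0 ≈⟨ *-assoc _ _ _ ⟩
    a 0 * (b 0 * d 0) ≈⟨ trans (⊛-coeff-zero a (b ⊛ d)) (*-cong refl (⊛-coeff-zero b d)) ⟨
    (a ⊛ (b ⊛ d)) 0   ∎
    where open ≈-Reasoning
  ⊛-assoc a b d (suc n) = begin
    ((a ⊛ b) ⊛ d) (suc n)
      ≈⟨ ⊛-coeff-sucˡ (a ⊛ b) d n ⟩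
    (a ⊛ b) 0 * d (suc n) + (÷X (a ⊛ b) ⊛ d) n
      ≈⟨ +-cong (*-cong (⊛-coeff-zero a b) refl) (trans (⊛-congʳ d (÷X-⊛ a b) n) (⊛-distribʳ d _ _ n)) ⟩
    (a 0 * b 0) * d (suc n) + (((a 0 ·S ÷X b) ⊛ d) n + ((÷X a ⊛ b) ⊛ d) n)
      ≈⟨ +-cong refl (+-cong (·S-⊛ (a 0) (÷X b) d n) (⊛-assoc (÷X a) b d n)) ⟩
    (a 0 * b 0) * d (suc n) + (a 0 * (÷X b ⊛ d) n + (÷X a ⊛ (b ⊛ d)) n)
      ≈⟨ regroup _ _ _ _ _ ⟩
    a 0 * (b 0 * d (suc n) + (÷X b ⊛ d) n) + (÷X a ⊛ (b ⊛ d)) n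
      ≈⟨ +-cong (*-cong refl (⊛-coeff-sucˡ b d n)) refl ⟨
    a 0 * (b ⊛ d) (suc n) + (÷X a ⊛ (b ⊛ d)) n
      ≈⟨ ⊛-coeff-sucˡ a (b ⊛ d) n ⟨
    (a ⊛ (b ⊛ d)) (suc n)
      ∎
    where
    open ≈-Reasoning
    regroup : ∀ x y z u v → (x * y) * z + (x * u + v) ≈ x * (y * z + u) + v
    regroup = solve 5 (λ x y z u v → (x :* y) :* z :+ (x :* u :+ v) := x :* (y :* z :+ u) :+ v) refl

  ⊛-zeroˡ : ∀ a → (0S ⊛ a) ≋ 0S
  ⊛-zeroˡ a n = sumTo-zero (suc n) (λ k _ → zeroˡ _)

  ⊛-identityˡ : ∀ a → (one ⊛ a) ≋ a
  ⊛-identityˡ a zero    = trans (⊛-coeff-zero one a) (*-identityˡ _)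
  ⊛-identityˡ a (suc n) = begin
    (one ⊛ a) (suc n)               ≈⟨ ⊛-coeff-sucˡ one a n ⟩
    1# * a (suc n) + (÷X one ⊛ a) n ≈⟨ +-cong (*-identityˡ _) (⊛-zeroˡ a n) ⟩
    a (suc n) + 0#                  ≈⟨ +-identityʳ _ ⟩
    a (suc n)                       ∎
    where open ≈-Reasoning

  ⊛-commutativeSemiring : CommutativeSemiring c ℓ
  ⊛-commutativeSemiring = record
    { Carrier               = Series
    ; _≈_                   = _≋_
    ; _+_                   = _+S_
    ; _*_                   = _⊛_
    ; 0#                    = 0S
    ; 1#                    = one
    ; isCommutativeSemiring = isCommutativeSemiringˡ record
      { +-isCommutativeMonoid = isCommutativeMonoidˡ record
        { isSemigroup = record
          { isMagma = record { isEquivalence = ≋-isEquivalence ; ∙-cong = λ p q n → +-cong (p n) (q n) }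
          ; assoc   = λ a b d n → +-assoc (a n) (b n) (d n)
          }
        ; identityˡ = λ a n → +-identityˡ (a n)
        ; comm      = λ a b n → +-comm (a n) (b n)
        }
      ; *-isCommutativeMonoid = isCommutativeMonoidˡ record
        { isSemigroup = record
          { isMagma = record { isEquivalence = ≋-isEquivalence ; ∙-cong = ⊛-cong }
          ; assoc   = ⊛-assoc
          }
        ; identityˡ = ⊛-identityˡ
        ; comm      = ⊛-comm
        }
      ; distribʳ = ⊛-distribʳ
      ; zeroˡ    = ⊛-zeroˡ
      }
    }
    where open Setoid ≋-setoid using () renaming (isEquivalence to ≋-isEquivalence)

  open CommutativeSemiring ⊛-commutativeSemiring
    using () renaming (*-identityʳ to ⊛-identityʳ; distribˡ to ⊛-distribˡ; zeroʳ to ⊛-zeroʳ)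
  open NaturalSolver ⊛-commutativeSemiring
    using () renaming (solve to ⊛-solve; _:+_ to _⊕_; _:*_ to _⊗_; _:=_ to _⊜_; con to ⊛-con)

  X·-cong : ∀ {a b} → a ≋ b → X· a ≋ X· b
  X·-cong a≋b zero    = refl
  X·-cong a≋b (suc n) = a≋b n

  ÷X-cong : ∀ {a b} → a ≋ b → ÷X a ≋ ÷X b
  ÷X-cong a≋b n = a≋b (suc n)

  X·-÷X : ∀ h → h 0 ≈ 0# → X· (÷X h) ≋ h
  X·-÷X h h₀ zero    = sym h₀
  X·-÷X h h₀ (suc n) = refl

  X·-⊛ : ∀ a b → (X· a ⊛ b) ≋ X· (a ⊛ b)
  X·-⊛ a b zero    = trans (⊛-coeff-zero (X· a) b) (zeroˡ _)
  X·-⊛ a b (suc n) = trans (⊛-coeff-sucˡ (X· a) b n) (trans (+-cong (zeroˡ _) refl) (+-identityˡ _))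

  ⊛-X· : ∀ a b → (a ⊛ X· b) ≋ X· (a ⊛ b)
  ⊛-X· a b = ≋-trans (⊛-comm a (X· b)) (≋-trans (X·-⊛ b a) (X·-cong (⊛-comm b a)))

  xS-⊛ : ∀ a → (xS ⊛ a) ≋ X· a
  xS-⊛ a = ≋-trans (X·-⊛ one a) (X·-cong (⊛-identityˡ a))

  X·-⊛-X·-⊛-X· : ∀ a b d → (X· a ⊛ (X· b ⊛ X· d)) ≋ X· (X· (X· (a ⊛ (b ⊛ d))))
  X·-⊛-X·-⊛-X· a b d = begin
    X· a ⊛ (X· b ⊛ X· d)        ≈⟨ ⊛-congˡ (X· a) (≋-trans (X·-⊛ b (X· d)) (X·-cong (⊛-X· b d))) ⟩
    X· a ⊛ X· (X· (b ⊛ d))      ≈⟨ X·-⊛ a (X· (X· (b ⊛ d))) ⟩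
    X· (a ⊛ X· (X· (b ⊛ d)))    ≈⟨ X·-cong (≋-trans (⊛-X· a (X· (b ⊛ d))) (X·-cong (⊛-X· a (b ⊛ d)))) ⟩
    X· (X· (X· (a ⊛ (b ⊛ d))))  ∎
    where open ≋-Reasoning

  ·S-one-⊛ : ∀ x a → ((x ·S one) ⊛ a) ≋ (x ·S a)
  ·S-one-⊛ x a n = trans (·S-⊛ x one a n) (*-cong refl (⊛-identityˡ a n))

  ⊛-·S : ∀ x a b → (a ⊛ (x ·S b)) ≋ (x ·S (a ⊛ b))
  ⊛-·S x a b = ≋-trans (⊛-comm a (x ·S b)) (≋-trans (·S-⊛ x b a) (λ n → *-cong refl (⊛-comm b a n)))

  ⊛-cong-shifted : ∀ h {s t} m → h 0 ≈ 0# → s ≋[ m ] t → (h ⊛ s) (suc m) ≈ (h ⊛ t) (suc m)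
  ⊛-cong-shifted h {s} {t} m h₀ s≋t = begin
    (h ⊛ s) (suc m)                ≈⟨ ⊛-coeff-sucˡ h s m ⟩
    h 0 * s (suc m) + (÷X h ⊛ s) m ≈⟨ +-cong (x≈0⇒x*y≈0 _ h₀) (⊛-cong-upTo m (λ _ _ → refl) s≋t) ⟩
    0# + (÷X h ⊛ t) m              ≈⟨ +-cong (x≈0⇒x*y≈0 _ h₀) refl ⟨
    h 0 * t (suc m) + (÷X h ⊛ t) m ≈⟨ ⊛-coeff-sucˡ h t m ⟨
    (h ⊛ t) (suc m)                ∎
    where open ≈-Reasoning

  ⊛-coeff-zero-one : ∀ a b → a 0 ≈ 1# → b 0 ≈ 1# → (a ⊛ b) 0 ≈ 1#
  ⊛-coeff-zero-one a b a₀ b₀ = trans (⊛-coeff-zero a b) (trans (*-cong a₀ b₀) (*-identityˡ 1#))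

  pow-cong : ∀ {a b} k → a ≋ b → pow a k ≋ pow b k
  pow-cong zero    a≋b = ≋-refl
  pow-cong (suc k) a≋b = ⊛-cong a≋b (pow-cong k a≋b)

  pow-coeff-zero : ∀ u → u 0 ≈ 1# → ∀ k → pow u k 0 ≈ 1#
  pow-coeff-zero u u₀ zero    = refl
  pow-coeff-zero u u₀ (suc k) = ⊛-coeff-zero-one u (pow u k) u₀ (pow-coeff-zero u u₀ k)

  pow-coeff-below : ∀ h → h 0 ≈ 0# → ∀ k n → n < k → pow h k n ≈ 0#
  pow-coeff-below h h₀ (suc k) zero    _         = trans (⊛-coeff-zero h (pow h k)) (x≈0⇒x*y≈0 _ h₀)
  pow-coeff-below h h₀ (suc k) (suc n) (s≤s n<k) = begin
    (h ⊛ pow h k) (suc n) ≈⟨ ⊛-cong-shifted h n h₀ (λ j j≤n → pow-coeff-below h h₀ k j (ℕₚ.≤-<-trans j≤n n<k)) ⟩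
    (h ⊛ 0S) (suc n)      ≈⟨ ⊛-zeroʳ h (suc n) ⟩
    0#                    ∎
    where open ≈-Reasoning

  pow-coeff-diagonal : ∀ h → h 0 ≈ 0# → h 1 ≈ 1# → ∀ k → pow h k k ≈ 1#
  pow-coeff-diagonal h h₀ h₁ zero    = refl
  pow-coeff-diagonal h h₀ h₁ (suc k) = begin
    (h ⊛ pow h k) (suc k)         ≈⟨ ⊛-congʳ (pow h k) (≋-sym (X·-÷X h h₀)) (suc k) ⟩
    (X· (÷X h) ⊛ pow h k) (suc k) ≈⟨ X·-⊛ (÷X h) (pow h k) (suc k) ⟩
    (÷X h ⊛ pow h k) k            ≈⟨ sumTo-sucˡ (λ j → ÷X h j * pow h k (k ∸ j)) k ⟩
    h 1 * pow h k k + sumTo (λ j → h (suc (suc j)) * pow h k (k ∸ suc j)) k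
      ≈⟨ +-cong (*-cong h₁ (pow-coeff-diagonal h h₀ h₁ k)) (sumTo-zero k (λ j j<k →
           y≈0⇒x*y≈0 _ (pow-coeff-below h h₀ k (k ∸ suc j) (ℕₚ.∸-monoʳ-< {o = 0} (s≤s z≤n) j<k)))) ⟩
    1# * 1# + 0#                  ≈⟨ trans (+-identityʳ _) (*-identityˡ _) ⟩
    1#                            ∎
    where open ≈-Reasoning

  -- Composition

  compose-cong : ∀ {F G h k} → F ≋ G → h ≋ k → compose F h ≋ compose G k
  compose-cong F≋G h≋k n = sumTo-cong (suc n) (λ j _ → *-cong (F≋G j) (pow-cong j h≋k n))

  compose-congˡ : ∀ {F G} h → F ≋ G → compose F h ≋ compose G h
  compose-congˡ h F≋G = compose-cong F≋G (λ _ → refl)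

  compose-congʳ : ∀ F {h k} → h ≋ k → compose F h ≋ compose F k
  compose-congʳ F = compose-cong {F = F} ≋-refl

  compose-coeff-zero : ∀ F h → compose F h 0 ≈ F 0
  compose-coeff-zero F h = trans (+-identityˡ _) (*-identityʳ _)

  compose-coeff-one : ∀ F h → F 0 ≈ 0# → h 0 ≈ 0# → h 1 ≈ 1# → compose F h 1 ≈ F 1
  compose-coeff-one F h F₀ h₀ h₁ = trans
    (+-cong (trans (+-identityˡ _) (x≈0⇒x*y≈0 _ F₀)) (trans (*-cong refl (pow-coeff-diagonal h h₀ h₁ 1)) (*-identityʳ _)))
    (+-identityˡ _)

  compose-+ : ∀ F G h → compose (F +S G) h ≋ (compose F h +S compose G h)
  compose-+ F G h n = trans (sumTo-cong (suc n) (λ _ _ → distribʳ _ _ _)) (sumTo-distrib-+ _ _ (suc n))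

  compose-·S : ∀ x F h → compose (x ·S F) h ≋ (x ·S compose F h)
  compose-·S x F h n = trans (sumTo-cong (suc n) (λ _ _ → *-assoc _ _ _)) (*-distribˡ-sumTo x _ (suc n))

  compose-one : ∀ h → compose one h ≋ one
  compose-one h n = begin
    compose one h n                                   ≈⟨ sumTo-sucˡ (λ k → one k * pow h k n) n ⟩
    1# * one n + sumTo (λ k → 0# * pow h (suc k) n) n ≈⟨ +-cong (*-identityˡ _) (sumTo-zero n (λ _ _ → zeroˡ _)) ⟩
    one n + 0#                                        ≈⟨ +-identityʳ _ ⟩
    one n                                             ∎
    where open ≈-Reasoning

  sumSeries : (ℕ → Series) → ℕ → Series
  sumSeries F N n = sumTo (λ k → F k n) N

  ⊛-sumSeries : ∀ a F N → (a ⊛ sumSeries F N) ≋ sumSeries (λ k → a ⊛ F k) N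
  ⊛-sumSeries a F zero    = ⊛-zeroʳ a
  ⊛-sumSeries a F (suc N) =
    ≋-trans (⊛-distribˡ a (sumSeries F N) (F N)) (λ n → +-cong (⊛-sumSeries a F N n) refl)

  compose-coeff-partialSum : ∀ F h → h 0 ≈ 0# → ∀ {j N} → j < N →
                             compose F h j ≈ sumSeries (λ k → F k ·S pow h k) N j
  compose-coeff-partialSum F h h₀ {j} j<N = sym (sumTo-vanishing-tail (λ k → F k * pow h k j) j<N
    (λ k j<k → y≈0⇒x*y≈0 _ (pow-coeff-below h h₀ k j j<k)))

  compose-coeff-suc : ∀ F h → h 0 ≈ 0# → ∀ m → compose F h (suc m) ≈ (h ⊛ compose (÷X F) h) (suc m)
  compose-coeff-suc F h h₀ m = begin
    compose F h (suc m)
      ≈⟨ sumTo-sucˡ (λ k → F k * pow h k (suc m)) (suc m) ⟩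
    F 0 * 0# + sumTo (λ k → F (suc k) * pow h (suc k) (suc m)) (suc m)
      ≈⟨ +-cong (sym (zeroʳ _)) (sumTo-vanishing-tail _ (ℕₚ.n≤1+n _) (λ k m<k →
           y≈0⇒x*y≈0 _ (pow-coeff-below h h₀ (suc k) (suc m) (s≤s m<k)))) ⟨
    0# + sumTo (λ k → F (suc k) * pow h (suc k) (suc m)) (suc (suc m))
      ≈⟨ +-cong refl (sumTo-cong (suc (suc m)) (λ k _ → ⊛-·S (F (suc k)) h (pow h k) (suc m))) ⟨
    0# + sumSeries (λ k → h ⊛ (F (suc k) ·S pow h k)) (suc (suc m)) (suc m)
      ≈⟨ +-cong refl (⊛-sumSeries h (λ k → F (suc k) ·S pow h k) (suc (suc m)) (suc m)) ⟨
    0# + (h ⊛ sumSeries (λ k → F (suc k) ·S pow h k) (suc (suc m))) (suc m)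
      ≈⟨ +-identityˡ _ ⟩
    (h ⊛ sumSeries (λ k → F (suc k) ·S pow h k) (suc (suc m))) (suc m)
      ≈⟨ ⊛-cong-upTo (suc m) (λ _ _ → refl) (λ j j≤1+m → sym (compose-coeff-partialSum (÷X F) h h₀ (s≤s j≤1+m))) ⟩
    (h ⊛ compose (÷X F) h) (suc m)
      ∎
    where open ≈-Reasoning

  horner : ∀ F h → h 0 ≈ 0# → compose F h ≋ (F 0 ·S one +S h ⊛ compose (÷X F) h)
  horner F h h₀ zero = begin
    compose F h 0                       ≈⟨ compose-coeff-zero F h ⟩
    F 0                                 ≈⟨ *-identityʳ _ ⟨
    F 0 * 1#                            ≈⟨ +-identityʳ _ ⟨
    F 0 * 1# + 0#                       ≈⟨ +-cong refl (trans (⊛-coeff-zero h (compose (÷X F) h)) (x≈0⇒x*y≈0 _ h₀)) ⟨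
    F 0 * 1# + (h ⊛ compose (÷X F) h) 0 ∎
    where open ≈-Reasoning
  horner F h h₀ (suc m) =
    trans (compose-coeff-suc F h h₀ m) (sym (trans (+-cong (zeroʳ _) refl) (+-identityˡ _)))

  compose-X· : ∀ F h → h 0 ≈ 0# → compose (X· F) h ≋ (h ⊛ compose F h)
  compose-X· F h h₀ = ≋-trans (horner (X· F) h h₀) (λ n → trans (+-cong (zeroˡ _) refl) (+-identityˡ _))

  compose-identityˡ : ∀ h → h 0 ≈ 0# → compose xS h ≋ h
  compose-identityˡ h h₀ = ≋-trans (compose-X· one h h₀) (≋-trans (⊛-congˡ h (compose-one h)) (⊛-identityʳ h))

  compose-identityʳ : ∀ F → compose F xS ≋ F
  compose-identityʳ F n = go n F
    where
    go : ∀ n F → compose F xS n ≈ F n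
    go zero    F = compose-coeff-zero F xS
    go (suc m) F = trans (compose-coeff-suc F xS refl m) (trans (xS-⊛ (compose (÷X F) xS) (suc m)) (go m (÷X F)))

  compose-⊛ : ∀ F G h → h 0 ≈ 0# → compose (F ⊛ G) h ≋ (compose F h ⊛ compose G h)
  compose-⊛ F G h h₀ n = go n F G n ℕₚ.≤-refl
    where
    open ≈-Reasoning
    Ĉ : Series → Series
    Ĉ F = compose F h
    go : ∀ n F G → Ĉ (F ⊛ G) ≋[ n ] (Ĉ F ⊛ Ĉ G)
    go zero F G zero z≤n = begin
      Ĉ (F ⊛ G) 0   ≈⟨ trans (compose-coeff-zero (F ⊛ G) h) (⊛-coeff-zero F G) ⟩
      F 0 * G 0     ≈⟨ *-cong (compose-coeff-zero F h) (compose-coeff-zero G h) ⟨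
      Ĉ F 0 * Ĉ G 0 ≈⟨ ⊛-coeff-zero (Ĉ F) (Ĉ G) ⟨
      (Ĉ F ⊛ Ĉ G) 0 ∎
    go (suc m) F G = ≋[]-suc m (go m F G) (begin
      Ĉ (F ⊛ G) (suc m)
        ≈⟨ compose-coeff-suc (F ⊛ G) h h₀ m ⟩
      (h ⊛ Ĉ (÷X (F ⊛ G))) (suc m)
        ≈⟨ ⊛-cong-shifted h m h₀ Ĉ-÷X-⊛ ⟩
      (h ⊛ (F 0 ·S Ĉ (÷X G) +S Ĉ (÷X F) ⊛ Ĉ G)) (suc m)
        ≈⟨ ⊛-distribˡ h (F 0 ·S Ĉ (÷X G)) (Ĉ (÷X F) ⊛ Ĉ G) (suc m) ⟩
      (h ⊛ (F 0 ·S Ĉ (÷X G))) (suc m) + (h ⊛ (Ĉ (÷X F) ⊛ Ĉ G)) (suc m)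
        ≈⟨ +-cong (trans (⊛-·S (F 0) h (Ĉ (÷X G)) (suc m)) (*-cong refl (sym (compose-coeff-suc G h h₀ m))))
                  (sym (⊛-assoc h (Ĉ (÷X F)) (Ĉ G) (suc m))) ⟩
      F 0 * Ĉ G (suc m) + ((h ⊛ Ĉ (÷X F)) ⊛ Ĉ G) (suc m)
        ≈⟨ +-cong (·S-one-⊛ (F 0) (Ĉ G) (suc m)) refl ⟨
      ((F 0 ·S one) ⊛ Ĉ G) (suc m) + ((h ⊛ Ĉ (÷X F)) ⊛ Ĉ G) (suc m)
        ≈⟨ ⊛-distribʳ (Ĉ G) (F 0 ·S one) (h ⊛ Ĉ (÷X F)) (suc m) ⟨
      ((F 0 ·S one +S h ⊛ Ĉ (÷X F)) ⊛ Ĉ G) (suc m)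
        ≈⟨ ⊛-congʳ (Ĉ G) (horner F h h₀) (suc m) ⟨
      (Ĉ F ⊛ Ĉ G) (suc m)
        ∎)
      where
      Ĉ-÷X-⊛ : Ĉ (÷X (F ⊛ G)) ≋[ m ] (F 0 ·S Ĉ (÷X G) +S Ĉ (÷X F) ⊛ Ĉ G)
      Ĉ-÷X-⊛ k k≤m = begin
        Ĉ (÷X (F ⊛ G)) k                      ≈⟨ compose-congˡ h (÷X-⊛ F G) k ⟩
        Ĉ (F 0 ·S ÷X G +S ÷X F ⊛ G) k         ≈⟨ compose-+ (F 0 ·S ÷X G) (÷X F ⊛ G) h k ⟩
        Ĉ (F 0 ·S ÷X G) k + Ĉ (÷X F ⊛ G) k    ≈⟨ +-cong (compose-·S (F 0) (÷X G) h k) (go m (÷X F) G k k≤m) ⟩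
        F 0 * Ĉ (÷X G) k + (Ĉ (÷X F) ⊛ Ĉ G) k ∎

  compose-assoc : ∀ F G h → G 0 ≈ 0# → h 0 ≈ 0# → compose (compose F G) h ≋ compose F (compose G h)
  compose-assoc F G h G₀ h₀ n = go n F n ℕₚ.≤-refl
    where
    open ≈-Reasoning
    K : Series
    K = compose G h
    K₀ : K 0 ≈ 0#
    K₀ = trans (compose-coeff-zero G h) G₀
    go : ∀ n F → compose (compose F G) h ≋[ n ] compose F K
    go zero    F zero z≤n =
      trans (compose-coeff-zero (compose F G) h) (trans (compose-coeff-zero F G) (sym (compose-coeff-zero F K)))
    go (suc m) F = ≋[]-suc m (go m F) (begin
      compose (compose F G) h (suc m)
        ≈⟨ compose-congˡ h (horner F G G₀) (suc m) ⟩
      compose (F 0 ·S one +S G ⊛ compose (÷X F) G) h (suc m)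
        ≈⟨ compose-+ (F 0 ·S one) (G ⊛ compose (÷X F) G) h (suc m) ⟩
      compose (F 0 ·S one) h (suc m) + compose (G ⊛ compose (÷X F) G) h (suc m)
        ≈⟨ +-cong (trans (compose-·S (F 0) one h (suc m)) (*-cong refl (compose-one h (suc m))))
                  (compose-⊛ G (compose (÷X F) G) h h₀ (suc m)) ⟩
      F 0 * 0# + (K ⊛ compose (compose (÷X F) G) h) (suc m)
        ≈⟨ +-cong (zeroʳ _) (⊛-cong-shifted K m K₀ (go m (÷X F))) ⟩
      0# + (K ⊛ compose (÷X F) K) (suc m)
        ≈⟨ trans (+-identityˡ _) (sym (compose-coeff-suc F K K₀ m)) ⟩
      compose F K (suc m)
        ∎)

  -- Series defined by course-of-values recursion

  truncate : ℕ → Series → Series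
  truncate n s k with k <? n
  ... | yes _ = s k
  ... | no  _ = 0#

  remainder : ℕ → Series → Series
  remainder n s k with k <? n
  ... | yes _ = 0#
  ... | no  _ = s k

  truncate-< : ∀ n s {k} → k < n → truncate n s k ≈ s k
  truncate-< n s {k} k<n with k <? n
  ... | yes _   = refl
  ... | no  k≮n = contradiction k<n k≮n

  truncate-self : ∀ n s → truncate n s n ≈ 0#
  truncate-self n s with n <? n
  ... | yes n<n = contradiction n<n (ℕₚ.<-irrefl ≡.refl)
  ... | no  _   = refl

  truncate-cong-upTo : ∀ {s t} m → s ≋[ m ] t → truncate (suc m) s ≋ truncate (suc m) t
  truncate-cong-upTo m s≋t k with k <? suc m
  ... | yes k<1+m = s≋t k (ℕₚ.≤-pred k<1+m)
  ... | no  _     = refl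

  remainder-< : ∀ n s {k} → k < n → remainder n s k ≈ 0#
  remainder-< n s {k} k<n with k <? n
  ... | yes _   = refl
  ... | no  k≮n = contradiction k<n k≮n

  remainder-self : ∀ n s → remainder n s n ≈ s n
  remainder-self n s with n <? n
  ... | yes n<n = contradiction n<n (ℕₚ.<-irrefl ≡.refl)
  ... | no  _   = refl

  truncate+remainder : ∀ n s → (truncate n s +S remainder n s) ≋ s
  truncate+remainder n s k with k <? n
  ... | yes _ = +-identityʳ _
  ... | no  _ = +-identityˡ _

  ⊛-truncate-coeff : ∀ a b n → (a ⊛ truncate (suc n) b) (suc n) ≈ (÷X a ⊛ b) n
  ⊛-truncate-coeff a b n = begin
    (a ⊛ truncate (suc n) b) (suc n)
      ≈⟨ ⊛-coeff-sucˡ a (truncate (suc n) b) n ⟩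
    a 0 * truncate (suc n) b (suc n) + (÷X a ⊛ truncate (suc n) b) n
      ≈⟨ +-cong (y≈0⇒x*y≈0 (a 0) (truncate-self (suc n) b))
                (⊛-cong-upTo n (λ _ _ → refl) (λ k k≤n → truncate-< (suc n) b (s≤s k≤n))) ⟩
    0# + (÷X a ⊛ b) n
      ≈⟨ +-identityˡ _ ⟩
    (÷X a ⊛ b) n
      ∎
    where open ≈-Reasoning

  idx-++-< : ∀ xs y {k} → k < length xs → idx (xs ++ [ y ]) k ≡ idx xs k
  idx-++-< (x ∷ xs) y {zero}  _         = ≡.refl
  idx-++-< (x ∷ xs) y {suc k} (s≤s k<n) = idx-++-< xs y k<n

  idx-++-length : ∀ xs y → idx (xs ++ [ y ]) (length xs) ≡ y
  idx-++-length []       y = ≡.refl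
  idx-++-length (x ∷ xs) y = idx-++-length xs y

  idx-≥-length : ∀ xs {k} → length xs ≤ k → idx xs k ≡ 0#
  idx-≥-length []       _         = ≡.refl
  idx-≥-length (x ∷ xs) (s≤s n≤k) = idx-≥-length xs n≤k

  length-prefix : ∀ step n → length (prefix step n) ≡ n
  length-prefix step zero    = ≡.refl
  length-prefix step (suc n) =
    ≡.trans (length-++ (prefix step n)) (≡.trans (ℕₚ.+-comm _ 1) (≡.cong suc (length-prefix step n)))

  idx-prefix : ∀ step {n k} → k < n → idx (prefix step n) k ≡ recS step k
  idx-prefix step {suc n} {k} k<1+n with ℕₚ.m≤n⇒m<n∨m≡n (ℕₚ.≤-pred k<1+n)
  ... | inj₁ k<n    = ≡.trans
    (idx-++-< (prefix step n) _ (≡.subst (k <_) (≡.sym (length-prefix step n)) k<n))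
    (idx-prefix step k<n)
  ... | inj₂ ≡.refl = ≡.subst (λ j → idx (prefix step k ++ [ recS step k ]) j ≡ recS step k)
    (length-prefix step k) (idx-++-length (prefix step k) (recS step k))

  idx-prefix-truncate : ∀ step n → idx (prefix step n) ≋ truncate n (recS step)
  idx-prefix-truncate step n k with k <? n
  ... | yes k<n = reflexive (idx-prefix step k<n)
  ... | no  k≮n = reflexive
    (idx-≥-length (prefix step n) (≡.subst (_≤ k) (≡.sym (length-prefix step n)) (ℕₚ.≮⇒≥ k≮n)))

  -- Reciprocals and compositional inverses

  inv1-coeff-suc : ∀ a n → inv1 a (suc n) ≈ - (÷X a ⊛ inv1 a) n
  inv1-coeff-suc a n = -‿cong (sumTo-cong (suc n) (λ k _ →
    *-cong refl (reflexive (idx-prefix _ (s≤s (ℕₚ.m∸n≤m n k))))))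

  inv1-inverseʳ : ∀ a → a 0 ≈ 1# → (a ⊛ inv1 a) ≋ one
  inv1-inverseʳ a a₀ zero    = ⊛-coeff-zero-one a (inv1 a) a₀ refl
  inv1-inverseʳ a a₀ (suc n) = begin
    (a ⊛ inv1 a) (suc n)                     ≈⟨ ⊛-coeff-sucˡ a (inv1 a) n ⟩
    a 0 * inv1 a (suc n) + (÷X a ⊛ inv1 a) n ≈⟨ +-cong (trans (*-cong a₀ (inv1-coeff-suc a n)) (*-identityˡ _)) refl ⟩
    - (÷X a ⊛ inv1 a) n + (÷X a ⊛ inv1 a) n  ≈⟨ -‿inverseˡ _ ⟩
    0#                                       ∎
    where open ≈-Reasoning

  inv1-inverseˡ : ∀ a → a 0 ≈ 1# → (inv1 a ⊛ a) ≋ one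
  inv1-inverseˡ a a₀ = ≋-trans (⊛-comm (inv1 a) a) (inv1-inverseʳ a a₀)

  inv1-unique : ∀ a b → a 0 ≈ 1# → (a ⊛ b) ≋ one → inv1 a ≋ b
  inv1-unique a b a₀ ab≋1 = begin
    inv1 a            ≈⟨ ⊛-identityʳ (inv1 a) ⟨
    inv1 a ⊛ one      ≈⟨ ⊛-congˡ (inv1 a) ab≋1 ⟨
    inv1 a ⊛ (a ⊛ b)  ≈⟨ ⊛-assoc (inv1 a) a b ⟨
    (inv1 a ⊛ a) ⊛ b  ≈⟨ ⊛-congʳ b (inv1-inverseˡ a a₀) ⟩
    one ⊛ b           ≈⟨ ⊛-identityˡ b ⟩
    b                 ∎
    where open ≋-Reasoning

  inv1-cong : ∀ {a b} → a 0 ≈ 1# → a ≋ b → inv1 a ≋ inv1 b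
  inv1-cong {a} {b} a₀ a≋b =
    inv1-unique a (inv1 b) a₀ (≋-trans (⊛-congʳ (inv1 b) a≋b) (inv1-inverseʳ b (trans (sym (a≋b 0)) a₀)))

  ⊛-inv1-cancelʳ : ∀ a η → η 0 ≈ 1# → ((a ⊛ η) ⊛ inv1 η) ≋ a
  ⊛-inv1-cancelʳ a η η₀ = begin
    (a ⊛ η) ⊛ inv1 η  ≈⟨ ⊛-assoc a η (inv1 η) ⟩
    a ⊛ (η ⊛ inv1 η)  ≈⟨ ⊛-congˡ a (inv1-inverseʳ η η₀) ⟩
    a ⊛ one           ≈⟨ ⊛-identityʳ a ⟩
    a                 ∎
    where open ≋-Reasoning

  ⊛-inv1-cancel-middle : ∀ a b η → η 0 ≈ 1# → ((a ⊛ inv1 η) ⊛ (η ⊛ b)) ≋ (a ⊛ b)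
  ⊛-inv1-cancel-middle a b η η₀ = ≋-trans (regroup a b η (inv1 η)) (⊛-inv1-cancelʳ (a ⊛ b) η η₀)
    where
    regroup : ∀ a b η ι → ((a ⊛ ι) ⊛ (η ⊛ b)) ≋ (((a ⊛ b) ⊛ η) ⊛ ι)
    regroup = ⊛-solve 4 (λ a b η ι → (a ⊗ ι) ⊗ (η ⊗ b) ⊜ ((a ⊗ b) ⊗ η) ⊗ ι) ≋-refl

  -- Lₙ is chosen so that the coefficient of xⁿ in L(h) equals that of x, using [xⁿ] hⁿ = 1.
  compInverse : Series → Series
  compInverse h = recS step
    where
    step : ℕ → (ℕ → Carrier) → Carrier
    step n L = xS n - sumTo (λ k → L k * pow h k n) n

  compInverse-coeff : ∀ h n → compInverse h n ≈ xS n - sumTo (λ k → compInverse h k * pow h k n) n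
  compInverse-coeff h n =
    +-cong refl (-‿cong (sumTo-cong n (λ k k<n → *-cong (reflexive (idx-prefix _ k<n)) refl)))

  compInverse-coeff-zero : ∀ h → compInverse h 0 ≈ 0#
  compInverse-coeff-zero h = -‿inverseʳ 0#

  compInverse-coeff-one : ∀ h → compInverse h 1 ≈ 1#
  compInverse-coeff-one h = begin
    compInverse h 1                          ≈⟨ compInverse-coeff h 1 ⟩
    1# - (0# + compInverse h 0 * pow h 0 1)  ≈⟨ +-cong refl (-‿cong (trans (+-identityˡ _) (zeroʳ _))) ⟩
    1# - 0#                                  ≈⟨ trans (+-cong refl -0#≈0#) (+-identityʳ _) ⟩
    1#                                       ∎
    where open ≈-Reasoning

  compose-compInverseˡ : ∀ h → h 0 ≈ 0# → h 1 ≈ 1# → compose (compInverse h) h ≋ xS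
  compose-compInverseˡ h h₀ h₁ n = begin
    S + L n * pow h n n
      ≈⟨ +-cong refl (trans (*-cong (compInverse-coeff h n) (pow-coeff-diagonal h h₀ h₁ n)) (*-identityʳ _)) ⟩
    S + (xS n - S)       ≈⟨ +-comm _ _ ⟩
    (xS n - S) + S       ≈⟨ //-rightDividesˡ S (xS n) ⟩
    xS n                 ∎
    where
    open ≈-Reasoning
    L = compInverse h
    S = sumTo (λ k → L k * pow h k n) n

  -- L has a left inverse M of its own, and associativity gives M = M(L(h)) = (M(L))(h) = h.
  compose-compInverseʳ : ∀ h → h 0 ≈ 0# → h 1 ≈ 1# → compose h (compInverse h) ≋ xS
  compose-compInverseʳ h h₀ h₁ = ≋-trans (compose-congˡ L h≋M) (compose-compInverseˡ L L₀ L₁)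
    where
    open ≋-Reasoning
    L = compInverse h
    M = compInverse L
    L₀ = compInverse-coeff-zero h
    L₁ = compInverse-coeff-one h
    h≋M : h ≋ M
    h≋M = begin
      h                        ≈⟨ compose-identityˡ h h₀ ⟨
      compose xS h             ≈⟨ compose-congˡ h (compose-compInverseˡ L L₀ L₁) ⟨
      compose (compose M L) h  ≈⟨ compose-assoc M L h L₀ h₀ ⟩
      compose M (compose L h)  ≈⟨ compose-congʳ M (compose-compInverseˡ h h₀ h₁) ⟩
      compose M xS             ≈⟨ compose-identityʳ M ⟩
      M                        ∎

  compose-compInverse-cancel : ∀ F h → h 0 ≈ 0# → h 1 ≈ 1# → compose (compose F (compInverse h)) h ≋ F
  compose-compInverse-cancel F h h₀ h₁ = begin
    compose (compose F L) h  ≈⟨ compose-assoc F L h (compInverse-coeff-zero h) h₀ ⟩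
    compose F (compose L h)  ≈⟨ compose-congʳ F (compose-compInverseˡ h h₀ h₁) ⟩
    compose F xS             ≈⟨ compose-identityʳ F ⟩
    F                        ∎
    where
    open ≋-Reasoning
    L = compInverse h

  -- Cube roots

  3[⅓[z-x]]+x≈z : ∀ x z → natR 3 * (third * (z - x)) + x ≈ z
  3[⅓[z-x]]+x≈z x z = begin
    natR 3 * (third * (z - x)) + x ≈⟨ +-cong (*-assoc _ _ _) refl ⟨
    (natR 3 * third) * (z - x) + x ≈⟨ +-cong (trans (*-cong (recip-inv 2) refl) (*-identityˡ _)) refl ⟩
    (z - x) + x                    ≈⟨ //-rightDividesˡ x z ⟩
    z                              ∎
    where open ≈-Reasoning

  3y+x≈z⇒y≈⅓[z-x] : ∀ {x y z} → natR 3 * y + x ≈ z → y ≈ third * (z - x)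
  3y+x≈z⇒y≈⅓[z-x] {x} {y} {z} eq = begin
    y                              ≈⟨ *-identityˡ y ⟨
    1# * y                         ≈⟨ *-cong (trans (*-comm _ _) (recip-inv 2)) refl ⟨
    (third * natR 3) * y           ≈⟨ *-assoc _ _ _ ⟩
    third * (natR 3 * y)           ≈⟨ *-cong refl (//-rightDividesʳ x (natR 3 * y)) ⟨
    third * ((natR 3 * y + x) - x) ≈⟨ *-cong refl (+-cong eq refl) ⟩
    third * (z - x)                ∎
    where open ≈-Reasoning

  -- With t = u mod x^(m+1) and d = u - t, u³ = t³ + d(u² + ut + t²) where d starts at x^(m+1),
  -- so coefficient m+1 of u³ - t³ is d_(m+1)·3.
  cube-coeff-suc : ∀ u → u 0 ≈ 1# → ∀ m →
                   pow u 3 (suc m) ≈ natR 3 * u (suc m) + pow (truncate (suc m) u) 3 (suc m)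
  cube-coeff-suc u u₀ m = begin
    pow u 3 (suc m)                                     ≈⟨ pow-cong 3 (≋-sym (truncate+remainder (suc m) u)) (suc m) ⟩
    pow (t +S d) 3 (suc m)                              ≈⟨ difference-of-cubes t d (suc m) ⟩
    pow t 3 (suc m) + (d ⊛ E) (suc m)                   ≈⟨ +-cong refl (⊛-coeff-sucʳ d E m) ⟩
    pow t 3 (suc m) + ((d ⊛ ÷X E) m + d (suc m) * E 0)
      ≈⟨ +-cong refl (+-cong d⊛÷XE≈0 (*-cong (remainder-self (suc m) u) E₀)) ⟩
    pow t 3 (suc m) + (0# + u (suc m) * (1# + 1# + 1#)) ≈⟨ rearrange _ _ ⟩
    natR 3 * u (suc m) + pow t 3 (suc m)                ∎
    where
    open ≈-Reasoning
    t = truncate (suc m) u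
    d = remainder (suc m) u
    s = t +S d
    E = s ⊛ s +S s ⊛ t +S t ⊛ t
    t₀ : t 0 ≈ 1#
    t₀ = trans (truncate-< (suc m) u (s≤s z≤n)) u₀
    s₀ : s 0 ≈ 1#
    s₀ = trans (truncate+remainder (suc m) u 0) u₀
    E₀ : E 0 ≈ 1# + 1# + 1#
    E₀ = +-cong (+-cong (⊛-coeff-zero-one s s s₀ s₀) (⊛-coeff-zero-one s t s₀ t₀)) (⊛-coeff-zero-one t t t₀ t₀)
    d⊛÷XE≈0 : (d ⊛ ÷X E) m ≈ 0#
    d⊛÷XE≈0 = trans (⊛-cong-upTo {a′ = 0S} {b = ÷X E} m (λ k k≤m → remainder-< (suc m) u (s≤s k≤m)) (λ _ _ → refl))
                    (⊛-zeroˡ (÷X E) m)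
    difference-of-cubes : ∀ t d → pow (t +S d) 3 ≋ (pow t 3 +S d ⊛ ((t +S d) ⊛ (t +S d) +S (t +S d) ⊛ t +S t ⊛ t))
    difference-of-cubes = ⊛-solve 2 (λ t d →
      (t ⊕ d) ⊗ ((t ⊕ d) ⊗ ((t ⊕ d) ⊗ ⊛-con 1)) ⊜
      t ⊗ (t ⊗ (t ⊗ ⊛-con 1)) ⊕ d ⊗ ((t ⊕ d) ⊗ (t ⊕ d) ⊕ (t ⊕ d) ⊗ t ⊕ t ⊗ t)) ≋-refl
    rearrange : ∀ P y → P + (0# + y * (1# + 1# + 1#)) ≈ natR 3 * y + P
    rearrange = solve 2 (λ P y →
      P :+ (con 0 :+ y :* (con 1 :+ con 1 :+ con 1)) := (con 1 :+ (con 1 :+ (con 1 :+ con 0))) :* y :+ P) refl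

  cbrt1-coeff-suc : ∀ w m → cbrt1 w (suc m) ≈ third * (w (suc m) - pow (truncate (suc m) (cbrt1 w)) 3 (suc m))
  cbrt1-coeff-suc w m = *-cong refl (+-cong refl (-‿cong (pow-cong 3 (idx-prefix-truncate _ (suc m)) (suc m))))

  cbrt1-cube : ∀ w → w 0 ≈ 1# → pow (cbrt1 w) 3 ≋ w
  cbrt1-cube w w₀ zero    = trans (pow-coeff-zero (cbrt1 w) refl 3) (sym w₀)
  cbrt1-cube w w₀ (suc m) = begin
    pow u 3 (suc m)                         ≈⟨ cube-coeff-suc u refl m ⟩
    natR 3 * u (suc m) + T                  ≈⟨ +-cong (*-cong refl (cbrt1-coeff-suc w m)) refl ⟩
    natR 3 * (third * (w (suc m) - T)) + T  ≈⟨ 3[⅓[z-x]]+x≈z T (w (suc m)) ⟩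
    w (suc m)                               ∎
    where
    open ≈-Reasoning
    u = cbrt1 w
    T = pow (truncate (suc m) u) 3 (suc m)

  cbrt1-unique : ∀ w v → v 0 ≈ 1# → pow v 3 ≋ w → cbrt1 w ≋ v
  cbrt1-unique w v v₀ v³≋w n = go n n ℕₚ.≤-refl
    where
    open ≈-Reasoning
    go : ∀ n → cbrt1 w ≋[ n ] v
    go zero    zero z≤n = sym v₀
    go (suc m) = ≋[]-suc m (go m) (begin
      cbrt1 w (suc m)
        ≈⟨ cbrt1-coeff-suc w m ⟩
      third * (w (suc m) - pow (truncate (suc m) (cbrt1 w)) 3 (suc m))
        ≈⟨ *-cong refl (+-cong refl (-‿cong (pow-cong 3 (truncate-cong-upTo m (go m)) (suc m)))) ⟩
      third * (w (suc m) - pow (truncate (suc m) v) 3 (suc m))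
        ≈⟨ 3y+x≈z⇒y≈⅓[z-x] (trans (sym (cube-coeff-suc v v₀ m)) (v³≋w (suc m))) ⟨
      v (suc m)
        ∎)

  pow-X· : ∀ a → pow (X· a) 3 ≋ X· (X· (X· (pow a 3)))
  pow-X· a = begin
    X· a ⊛ (X· a ⊛ (X· a ⊛ one))  ≈⟨ ⊛-congˡ (X· a) (⊛-congˡ (X· a) (⊛-identityʳ (X· a))) ⟩
    X· a ⊛ (X· a ⊛ X· a)          ≈⟨ X·-⊛-X·-⊛-X· a a a ⟩
    X· (X· (X· (a ⊛ (a ⊛ a))))    ≈⟨ X·-cong (X·-cong (X·-cong (⊛-congˡ a (⊛-congˡ a (≋-sym (⊛-identityʳ a)))))) ⟩
    X· (X· (X· (pow a 3)))        ∎
    where open ≋-Reasoning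

  IsF-zero : ∀ {f} → IsF f → f 0 ≈ 0#
  IsF-zero (f∈ , _) = f∈ 0 (λ ())

  cubeRootSeries-cube : ∀ {p q r} → IsF p → IsF q → IsF r →
                        pow (÷X (cubeRootSeries p q r)) 3 ≋ (÷X p ⊛ (÷X q ⊛ ÷X r))
  cubeRootSeries-cube {p} {q} {r} p∈ q∈ r∈ = ≋-trans (cbrt1-cube w (trans (w≋ 0) product₀)) w≋
    where
    w = ÷X (÷X (÷X (p ⊛ (q ⊛ r))))
    w≋ : w ≋ (÷X p ⊛ (÷X q ⊛ ÷X r))
    w≋ = ÷X-cong (÷X-cong (÷X-cong (≋-trans
      (⊛-cong (≋-sym (X·-÷X p (IsF-zero p∈))) (⊛-cong (≋-sym (X·-÷X q (IsF-zero q∈))) (≋-sym (X·-÷X r (IsF-zero r∈)))))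
      (X·-⊛-X·-⊛-X· (÷X p) (÷X q) (÷X r)))))
    product₀ : (÷X p ⊛ (÷X q ⊛ ÷X r)) 0 ≈ 1#
    product₀ = ⊛-coeff-zero-one (÷X p) (÷X q ⊛ ÷X r) (proj₂ p∈) (⊛-coeff-zero-one (÷X q) (÷X r) (proj₂ q∈) (proj₂ r∈))

  cubeRootSeries-unique : ∀ p q r k → k 0 ≈ 0# → k 1 ≈ 1# → (p ⊛ (q ⊛ r)) ≋ pow k 3 → cubeRootSeries p q r ≋ k
  cubeRootSeries-unique p q r k k₀ k₁ pqr≋k³ = begin
    X· (cbrt1 (÷X (÷X (÷X (p ⊛ (q ⊛ r))))))  ≈⟨ X·-cong (cbrt1-unique _ (÷X k) k₁ (≋-sym w≋)) ⟩
    X· (÷X k)                                ≈⟨ X·-÷X k k₀ ⟩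
    k                                        ∎
    where
    open ≋-Reasoning
    w≋ : ÷X (÷X (÷X (p ⊛ (q ⊛ r)))) ≋ pow (÷X k) 3
    w≋ = ÷X-cong (÷X-cong (÷X-cong (≋-trans pqr≋k³ (≋-trans (pow-cong 3 (≋-sym (X·-÷X k k₀))) (pow-X· (÷X k))))))

  -- Supports in a residue class

  -- IsG s and IsF s are definitionally Supported 3 0 s × s 0 ≈ 1# and Supported 3 1 s × s 1 ≈ 1#.
  Supported : (d : ℕ) {{_ : NonZero d}} → ℕ → Series → Set ℓ
  Supported d r s = ∀ n → n % d ≢ r % d → s n ≈ 0#

  module _ {d : ℕ} {{_ : NonZero d}} where

    Supported-÷X : ∀ {r s} → Supported d (suc r) s → Supported d r (÷X s)
    Supported-÷X s∈ n n≢r = s∈ (suc n) (λ 1+n≡1+r → n≢r (%-cancel-suc {d} 1+n≡1+r))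

    Supported-X· : ∀ {r s} → Supported d r s → Supported d (suc r) (X· s)
    Supported-X· s∈ zero    _   = refl
    Supported-X· s∈ (suc n) n≢r = s∈ n (λ n≡r → n≢r (%-cong-suc {d} n≡r))

    Supported-⊛ : ∀ {r r′ a b} → Supported d r a → Supported d r′ b → Supported d (r +ℕ r′) (a ⊛ b)
    Supported-⊛ {r} {r′} {a} {b} a∈ b∈ n n≢r+r′ = sumTo-zero (suc n) term
      where
      term : ∀ k → k < suc n → a k * b (n ∸ k) ≈ 0#
      term k k<1+n with k % d ℕ.≟ r % d | (n ∸ k) % d ℕ.≟ r′ % d
      ... | no  k≢r | _        = x≈0⇒x*y≈0 (b (n ∸ k)) (a∈ k k≢r)
      ... | yes _   | no  j≢r′ = y≈0⇒x*y≈0 (a k) (b∈ (n ∸ k) j≢r′)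
      ... | yes k≡r | yes j≡r′ = contradiction
        (≡.trans (≡.cong (_% d) (≡.sym (ℕₚ.m+[n∸m]≡n (ℕₚ.≤-pred k<1+n)))) (%-cong-+ {d} k≡r j≡r′)) n≢r+r′

    Supported-one : Supported d 0 one
    Supported-one zero    0≢0 = contradiction ≡.refl 0≢0
    Supported-one (suc n) _   = refl

    Supported-pow : ∀ {r h} → Supported d r h → ∀ k → Supported d (k ℕ.* r) (pow h k)
    Supported-pow h∈ zero    = Supported-one
    Supported-pow h∈ (suc k) = Supported-⊛ h∈ (Supported-pow h∈ k)

    pow-coeff-off-residue : ∀ {h r k n} → Supported d 1 h → k % d ≡ r % d → n % d ≢ r % d → pow h k n ≈ 0#
    pow-coeff-off-residue {k = k} h∈ k≡r n≢r =
      Supported-pow h∈ k _ (λ n≡k → n≢r (≡.trans n≡k (≡.trans (≡.cong (_% d) (ℕₚ.*-identityʳ k)) k≡r)))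

    Supported-compose : ∀ {r G h} → Supported d r G → Supported d 1 h → Supported d r (compose G h)
    Supported-compose {r} {G} {h} G∈ h∈ n n≢r = sumTo-zero (suc n) term
      where
      term : ∀ k → k < suc n → G k * pow h k n ≈ 0#
      term k _ with k % d ℕ.≟ r % d
      ... | no  k≢r = x≈0⇒x*y≈0 (pow h k n) (G∈ k k≢r)
      ... | yes k≡r = y≈0⇒x*y≈0 (G k) (pow-coeff-off-residue h∈ k≡r n≢r)

    Supported-truncate : ∀ {r} n s → (∀ {k} → k < n → k % d ≢ r % d → s k ≈ 0#) → Supported d r (truncate n s)
    Supported-truncate n s s∈ k k≢r with k <? n
    ... | yes k<n = s∈ k<n k≢r
    ... | no  _   = refl

    Supported-inv1 : ∀ {a} → Supported d 0 a → Supported d 0 (inv1 a)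
    Supported-inv1 {a} a∈ = <-rec _ step
      where
      step : ∀ n → (∀ {k} → k < n → k % d ≢ 0 % d → inv1 a k ≈ 0#) → n % d ≢ 0 % d → inv1 a n ≈ 0#
      step zero    _  0≢0   = contradiction ≡.refl 0≢0
      step (suc n) ih 1+n≢0 = begin
        inv1 a (suc n)                            ≈⟨ inv1-coeff-suc a n ⟩
        - (÷X a ⊛ inv1 a) n                       ≈⟨ -‿cong (⊛-truncate-coeff a (inv1 a) n) ⟨
        - (a ⊛ truncate (suc n) (inv1 a)) (suc n)
          ≈⟨ -‿cong (Supported-⊛ a∈ (Supported-truncate (suc n) (inv1 a) ih) (suc n) 1+n≢0) ⟩
        - 0#                                      ≈⟨ -0#≈0# ⟩
        0#                                        ∎
        where open ≈-Reasoning

    Supported-cbrt1 : ∀ {w} → Supported d 0 w → Supported d 0 (cbrt1 w)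
    Supported-cbrt1 {w} w∈ = <-rec _ step
      where
      step : ∀ n → (∀ {k} → k < n → k % d ≢ 0 % d → cbrt1 w k ≈ 0#) → n % d ≢ 0 % d → cbrt1 w n ≈ 0#
      step zero    _  0≢0   = contradiction ≡.refl 0≢0
      step (suc n) ih 1+n≢0 = begin
        cbrt1 w (suc n)
          ≈⟨ cbrt1-coeff-suc w n ⟩
        third * (w (suc n) - pow (truncate (suc n) (cbrt1 w)) 3 (suc n))
          ≈⟨ *-cong refl (+-cong (w∈ (suc n) 1+n≢0)
               (-‿cong (Supported-pow (Supported-truncate (suc n) (cbrt1 w) ih) 3 (suc n) 1+n≢0))) ⟩
        third * (0# - 0#)
          ≈⟨ y≈0⇒x*y≈0 third (-‿inverseʳ 0#) ⟩
        0#
          ∎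
        where open ≈-Reasoning

    Supported-compInverse : ∀ {h} → Supported d 1 h → Supported d 1 (compInverse h)
    Supported-compInverse {h} h∈ = <-rec _ step
      where
      step : ∀ n → (∀ {k} → k < n → k % d ≢ 1 % d → compInverse h k ≈ 0#) → n % d ≢ 1 % d → compInverse h n ≈ 0#
      step n ih n≢1 = begin
        compInverse h n                                    ≈⟨ compInverse-coeff h n ⟩
        xS n - sumTo (λ k → compInverse h k * pow h k n) n
          ≈⟨ +-cong (Supported-X· Supported-one n n≢1) (-‿cong (sumTo-zero n term)) ⟩
        0# - 0#                                            ≈⟨ -‿inverseʳ 0# ⟩
        0#                                                 ∎
        where
        open ≈-Reasoning
        term : ∀ k → k < n → compInverse h k * pow h k n ≈ 0#
        term k k<n with k % d ℕ.≟ 1 % d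
        ... | no  k≢1 = x≈0⇒x*y≈0 (pow h k n) (ih k<n k≢1)
        ... | yes k≡1 = y≈0⇒x*y≈0 (compInverse h k) (pow-coeff-off-residue h∈ k≡1 n≢1)

    cubeRootSeries-supported : ∀ {p q r} → Supported d 1 p → Supported d 1 q → Supported d 1 r →
                               Supported d 1 (cubeRootSeries p q r)
    cubeRootSeries-supported p∈ q∈ r∈ =
      Supported-X· {r = 0} (Supported-cbrt1 (Supported-÷X {r = 0} (Supported-÷X {r = 1} (Supported-÷X {r = 2}
        (Supported-⊛ {r = 1} {r′ = 2} p∈ (Supported-⊛ {r = 1} {r′ = 1} q∈ r∈))))))

  -- The triple Riordan group

  rootOf : Quad → Series
  rootOf a = cubeRootSeries (f₁ a) (f₂ a) (f₃ a)

  -- (f/h)·F(h); the f-components of a ∙ b are definitionally quotCompose (rootOf a) (fᵢ a) (fᵢ b).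
  quotCompose : Series → Series → Series → Series
  quotCompose h f F = (÷X f ⊛ inv1 (÷X h)) ⊛ compose F h

  inverseG : Series → Series → Series
  inverseG h g = compose (inv1 g) (compInverse h)

  inverseF : Series → Series → Series
  inverseF h f = compose (X· (÷X h ⊛ inv1 (÷X f))) (compInverse h)

  inverse : Quad → Quad
  inverse a = ⟨ inverseG h (g a) , inverseF h (f₁ a) , inverseF h (f₂ a) , inverseF h (f₃ a) ⟩
    where h = rootOf a

  IsG-∙ : ∀ {h g G} → Supported 3 1 h → IsG g → IsG G → IsG (g ⊛ compose G h)
  IsG-∙ {h} {g} {G} h∈ (g∈ , g₀) (G∈ , G₀) =
    Supported-⊛ {r = 0} {r′ = 0} g∈ (Supported-compose {r = 0} G∈ h∈) ,
    ⊛-coeff-zero-one g (compose G h) g₀ (trans (compose-coeff-zero G h) G₀)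

  IsF-quotCompose : ∀ {h f F} → Supported 3 1 h → h 1 ≈ 1# → IsF f → IsF F → IsF (quotCompose h f F)
  IsF-quotCompose {h} {f} {F} h∈ h₁ (f∈ , f₁) (F∈ , F₁) =
    Supported-⊛ {r = 0} {r′ = 1} A∈ (Supported-compose {r = 1} F∈ h∈) , (begin
      (A ⊛ C) 1              ≈⟨ +-cong (+-identityˡ _) refl ⟩
      A 0 * C 1 + A 1 * C 0  ≈⟨ +-cong (*-cong A₀ C₁) (y≈0⇒x*y≈0 (A 1) (trans (compose-coeff-zero F h) F₀)) ⟩
      1# * 1# + 0#           ≈⟨ trans (+-identityʳ _) (*-identityˡ 1#) ⟩
      1#                     ∎)
    where
    open ≈-Reasoning
    A = ÷X f ⊛ inv1 (÷X h)
    C = compose F h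
    A∈ : Supported 3 0 A
    A∈ = Supported-⊛ {r = 0} {r′ = 0} (Supported-÷X {r = 0} f∈) (Supported-inv1 (Supported-÷X {r = 0} h∈))
    A₀ : A 0 ≈ 1#
    A₀ = ⊛-coeff-zero-one (÷X f) (inv1 (÷X h)) f₁ refl
    F₀ : F 0 ≈ 0#
    F₀ = F∈ 0 (λ ())
    C₁ : C 1 ≈ 1#
    C₁ = trans (compose-coeff-one F h F₀ (h∈ 0 (λ ())) h₁) F₁

  InTR-e : InTR e
  InTR-e = (Supported-one , refl) , xS∈ , xS∈ , xS∈
    where
    xS∈ : IsF xS
    xS∈ = Supported-X· {r = 0} Supported-one , refl

  InTR-∙ : ∀ {a b} → InTR a → InTR b → InTR (a ∙ b)
  InTR-∙ (g∈ , f₁∈ , f₂∈ , f₃∈) (G∈ , F₁∈ , F₂∈ , F₃∈) =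
    IsG-∙ h∈ g∈ G∈ , IsF-quotCompose h∈ refl f₁∈ F₁∈ , IsF-quotCompose h∈ refl f₂∈ F₂∈ , IsF-quotCompose h∈ refl f₃∈ F₃∈
    where h∈ = cubeRootSeries-supported (proj₁ f₁∈) (proj₁ f₂∈) (proj₁ f₃∈)

  𝒜-∙ : ∀ h {g G} → g ≋ one → G ≋ one → (g ⊛ compose G h) ≋ one
  𝒜-∙ h g≋1 G≋1 = ≋-trans (⊛-cong g≋1 (≋-trans (compose-congˡ h G≋1) (compose-one h))) (⊛-identityˡ one)

  ℬ-∙ : ∀ h {g G f F} → h 0 ≈ 0# → h 1 ≈ 1# → f ≋ X· g → F ≋ X· G → quotCompose h f F ≋ X· (g ⊛ compose G h)
  ℬ-∙ h {g} {G} {f} {F} h₀ h₁ f≋xg F≋xG = begin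
    (÷X f ⊛ ι) ⊛ compose F h    ≈⟨ ⊛-cong (⊛-congʳ ι (÷X-cong f≋xg)) (compose-congˡ h F≋xG) ⟩
    (g ⊛ ι) ⊛ compose (X· G) h  ≈⟨ ⊛-congˡ (g ⊛ ι) (compose-X· G h h₀) ⟩
    (g ⊛ ι) ⊛ (h ⊛ C)           ≈⟨ ⊛-congˡ (g ⊛ ι) (⊛-congʳ C (≋-sym (X·-÷X h h₀))) ⟩
    (g ⊛ ι) ⊛ (X· (÷X h) ⊛ C)   ≈⟨ ⊛-congˡ (g ⊛ ι) (X·-⊛ (÷X h) C) ⟩
    (g ⊛ ι) ⊛ X· (÷X h ⊛ C)     ≈⟨ ⊛-X· (g ⊛ ι) (÷X h ⊛ C) ⟩
    X· ((g ⊛ ι) ⊛ (÷X h ⊛ C))   ≈⟨ X·-cong (⊛-inv1-cancel-middle g C (÷X h) h₁) ⟩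
    X· (g ⊛ C)                  ∎
    where
    open ≋-Reasoning
    ι = inv1 (÷X h)
    C = compose G h

  module _ {a : Quad} (a∈TR : InTR a) where
    private
      h = rootOf a
      η = ÷X h
      L = compInverse h
      κ = ÷X L
      ψ : Series → Series
      ψ f = η ⊛ inv1 (÷X f)
      g∈ : IsG (g a)
      g∈ = proj₁ a∈TR
      f₁∈ : IsF (f₁ a)
      f₁∈ = proj₁ (proj₂ a∈TR)
      f₂∈ : IsF (f₂ a)
      f₂∈ = proj₁ (proj₂ (proj₂ a∈TR))
      f₃∈ : IsF (f₃ a)
      f₃∈ = proj₂ (proj₂ (proj₂ a∈TR))
      L₀ : L 0 ≈ 0#
      L₀ = compInverse-coeff-zero h
      L₁ : L 1 ≈ 1#
      L₁ = compInverse-coeff-one h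

      inverseF-factor : ∀ f → inverseF h f ≋ (L ⊛ compose (ψ f) L)
      inverseF-factor f = compose-X· (ψ f) L L₀

      ψ-⊛-self : ∀ {f} → IsF f → (ψ f ⊛ f) ≋ h
      ψ-⊛-self {f} f∈ = begin
        (η ⊛ inv1 φ) ⊛ f       ≈⟨ ⊛-congˡ (η ⊛ inv1 φ) (≋-sym (X·-÷X f (IsF-zero f∈))) ⟩
        (η ⊛ inv1 φ) ⊛ X· φ    ≈⟨ ⊛-X· (η ⊛ inv1 φ) φ ⟩
        X· ((η ⊛ inv1 φ) ⊛ φ)  ≈⟨ X·-cong (⊛-assoc η (inv1 φ) φ) ⟩
        X· (η ⊛ (inv1 φ ⊛ φ))  ≈⟨ X·-cong (≋-trans (⊛-congˡ η (inv1-inverseˡ φ (proj₂ f∈))) (⊛-identityʳ η)) ⟩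
        X· η                   ≈⟨ X·-÷X h refl ⟩
        h                      ∎
        where
        open ≋-Reasoning
        φ = ÷X f

      ψ-product : (ψ (f₁ a) ⊛ (ψ (f₂ a) ⊛ ψ (f₃ a))) ≋ one
      ψ-product = begin
        (η ⊛ ι₁) ⊛ ((η ⊛ ι₂) ⊛ (η ⊛ ι₃))     ≈⟨ gather η ι₁ ι₂ ι₃ ⟩
        pow η 3 ⊛ (ι₁ ⊛ (ι₂ ⊛ ι₃))           ≈⟨ ⊛-congʳ (ι₁ ⊛ (ι₂ ⊛ ι₃)) (cubeRootSeries-cube f₁∈ f₂∈ f₃∈) ⟩
        (φ₁ ⊛ (φ₂ ⊛ φ₃)) ⊛ (ι₁ ⊛ (ι₂ ⊛ ι₃))  ≈⟨ pair φ₁ φ₂ φ₃ ι₁ ι₂ ι₃ ⟩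
        (φ₁ ⊛ ι₁) ⊛ ((φ₂ ⊛ ι₂) ⊛ (φ₃ ⊛ ι₃))
          ≈⟨ ⊛-cong (inv1-inverseʳ φ₁ (proj₂ f₁∈)) (⊛-cong (inv1-inverseʳ φ₂ (proj₂ f₂∈)) (inv1-inverseʳ φ₃ (proj₂ f₃∈))) ⟩
        one ⊛ (one ⊛ one)                    ≈⟨ ≋-trans (⊛-identityˡ (one ⊛ one)) (⊛-identityˡ one) ⟩
        one                                  ∎
        where
        open ≋-Reasoning
        φ₁ = ÷X (f₁ a)
        φ₂ = ÷X (f₂ a)
        φ₃ = ÷X (f₃ a)
        ι₁ = inv1 φ₁
        ι₂ = inv1 φ₂
        ι₃ = inv1 φ₃
        gather : ∀ η ι₁ ι₂ ι₃ → ((η ⊛ ι₁) ⊛ ((η ⊛ ι₂) ⊛ (η ⊛ ι₃))) ≋ (pow η 3 ⊛ (ι₁ ⊛ (ι₂ ⊛ ι₃)))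
        gather = ⊛-solve 4 (λ η ι₁ ι₂ ι₃ →
          (η ⊗ ι₁) ⊗ ((η ⊗ ι₂) ⊗ (η ⊗ ι₃)) ⊜ (η ⊗ (η ⊗ (η ⊗ ⊛-con 1))) ⊗ (ι₁ ⊗ (ι₂ ⊗ ι₃))) ≋-refl
        pair : ∀ φ₁ φ₂ φ₃ ι₁ ι₂ ι₃ →
               ((φ₁ ⊛ (φ₂ ⊛ φ₃)) ⊛ (ι₁ ⊛ (ι₂ ⊛ ι₃))) ≋ ((φ₁ ⊛ ι₁) ⊛ ((φ₂ ⊛ ι₂) ⊛ (φ₃ ⊛ ι₃)))
        pair = ⊛-solve 6 (λ φ₁ φ₂ φ₃ ι₁ ι₂ ι₃ →
          (φ₁ ⊗ (φ₂ ⊗ φ₃)) ⊗ (ι₁ ⊗ (ι₂ ⊗ ι₃)) ⊜ (φ₁ ⊗ ι₁) ⊗ ((φ₂ ⊗ ι₂) ⊗ (φ₃ ⊗ ι₃))) ≋-refl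

      -- Each fᵢ-component of the inverse is L·Ψᵢ, and Ψ₁Ψ₂Ψ₃ = (ψ₁ψ₂ψ₃)(L) = 1, so their product is L³.
      rootOf-inverse : rootOf (inverse a) ≋ L
      rootOf-inverse = cubeRootSeries-unique F₁ F₂ F₃ L L₀ L₁ (begin
        F₁ ⊛ (F₂ ⊛ F₃)
          ≈⟨ ⊛-cong (inverseF-factor (f₁ a)) (⊛-cong (inverseF-factor (f₂ a)) (inverseF-factor (f₃ a))) ⟩
        (L ⊛ Ψ₁) ⊛ ((L ⊛ Ψ₂) ⊛ (L ⊛ Ψ₃))
          ≈⟨ gather L Ψ₁ Ψ₂ Ψ₃ ⟩
        pow L 3 ⊛ (Ψ₁ ⊛ (Ψ₂ ⊛ Ψ₃))
          ≈⟨ ⊛-congˡ (pow L 3) (≋-trans (⊛-congˡ Ψ₁ (≋-sym (compose-⊛ (ψ (f₂ a)) (ψ (f₃ a)) L L₀)))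
                                        (≋-sym (compose-⊛ (ψ (f₁ a)) _ L L₀))) ⟩
        pow L 3 ⊛ compose (ψ (f₁ a) ⊛ (ψ (f₂ a) ⊛ ψ (f₃ a))) L
          ≈⟨ ⊛-congˡ (pow L 3) (≋-trans (compose-congˡ L ψ-product) (compose-one L)) ⟩
        pow L 3 ⊛ one
          ≈⟨ ⊛-identityʳ (pow L 3) ⟩
        pow L 3
          ∎)
        where
        open ≋-Reasoning
        F₁ = inverseF h (f₁ a)
        F₂ = inverseF h (f₂ a)
        F₃ = inverseF h (f₃ a)
        Ψ₁ = compose (ψ (f₁ a)) L
        Ψ₂ = compose (ψ (f₂ a)) L
        Ψ₃ = compose (ψ (f₃ a)) L
        gather : ∀ L Ψ₁ Ψ₂ Ψ₃ → ((L ⊛ Ψ₁) ⊛ ((L ⊛ Ψ₂) ⊛ (L ⊛ Ψ₃))) ≋ (pow L 3 ⊛ (Ψ₁ ⊛ (Ψ₂ ⊛ Ψ₃)))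
        gather = ⊛-solve 4 (λ L Ψ₁ Ψ₂ Ψ₃ →
          (L ⊗ Ψ₁) ⊗ ((L ⊗ Ψ₂) ⊗ (L ⊗ Ψ₃)) ⊜ (L ⊗ (L ⊗ (L ⊗ ⊛-con 1))) ⊗ (Ψ₁ ⊗ (Ψ₂ ⊗ Ψ₃))) ≋-refl

      quotCompose-inverse-self : ∀ {f} → IsF f → quotCompose (rootOf (inverse a)) (inverseF h f) f ≋ xS
      quotCompose-inverse-self {f} f∈ = begin
        (÷X F ⊛ inv1 (÷X k)) ⊛ compose f k
          ≈⟨ ⊛-cong (⊛-congˡ (÷X F) (inv1-cong refl (÷X-cong rootOf-inverse))) (compose-congʳ f rootOf-inverse) ⟩
        (÷X F ⊛ inv1 κ) ⊛ compose f L     ≈⟨ ⊛-congʳ (compose f L) (⊛-congʳ (inv1 κ) ÷X-F) ⟩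
        ((Ψ ⊛ κ) ⊛ inv1 κ) ⊛ compose f L  ≈⟨ ⊛-congʳ (compose f L) (⊛-inv1-cancelʳ Ψ κ L₁) ⟩
        Ψ ⊛ compose f L                   ≈⟨ compose-⊛ (ψ f) f L L₀ ⟨
        compose (ψ f ⊛ f) L               ≈⟨ compose-congˡ L (ψ-⊛-self f∈) ⟩
        compose h L                       ≈⟨ compose-compInverseʳ h refl refl ⟩
        xS                                ∎
        where
        open ≋-Reasoning
        k = rootOf (inverse a)
        F = inverseF h f
        Ψ = compose (ψ f) L
        ÷X-F : ÷X F ≋ (Ψ ⊛ κ)
        ÷X-F = ÷X-cong (≋-trans (inverseF-factor f)
                 (≋-trans (⊛-comm L Ψ) (≋-trans (⊛-congˡ Ψ (≋-sym (X·-÷X L L₀))) (⊛-X· Ψ κ))))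

    InTR-inverse : InTR (inverse a)
    InTR-inverse =
      (Supported-compose {r = 0} (Supported-inv1 (proj₁ g∈)) L∈ , compose-coeff-zero (inv1 (g a)) L) ,
      F∈ f₁∈ , F∈ f₂∈ , F∈ f₃∈
      where
      h∈ : Supported 3 1 h
      h∈ = cubeRootSeries-supported (proj₁ f₁∈) (proj₁ f₂∈) (proj₁ f₃∈)
      L∈ : Supported 3 1 L
      L∈ = Supported-compInverse h∈
      F∈ : ∀ {f} → IsF f → IsF (inverseF h f)
      F∈ {f} (f∈ , f₁) =
        Supported-compose {r = 1} (Supported-X· {r = 0} (Supported-⊛ {r = 0} {r′ = 0}
          (Supported-÷X {r = 0} h∈) (Supported-inv1 (Supported-÷X {r = 0} f∈)))) L∈ ,
        trans (compose-coeff-one (X· (ψ f)) L refl L₀ L₁) (⊛-coeff-zero-one η (inv1 (÷X f)) refl refl)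

    ∙-inverseʳ : (a ∙ inverse a) ≈Q e
    ∙-inverseʳ = g-part , f-part f₁∈ , f-part f₂∈ , f-part f₃∈
      where
      open ≋-Reasoning
      g-part : (g a ⊛ compose (inverseG h (g a)) h) ≋ one
      g-part = ≋-trans (⊛-congˡ (g a) (compose-compInverse-cancel (inv1 (g a)) h refl refl))
                       (inv1-inverseʳ (g a) (proj₂ g∈))
      f-part : ∀ {f} → IsF f → quotCompose h f (inverseF h f) ≋ xS
      f-part {f} f∈ = begin
        (÷X f ⊛ inv1 η) ⊛ compose (inverseF h f) h
          ≈⟨ ⊛-congˡ (÷X f ⊛ inv1 η) (compose-compInverse-cancel (X· (ψ f)) h refl refl) ⟩
        (÷X f ⊛ inv1 η) ⊛ X· (η ⊛ inv1 (÷X f))    ≈⟨ ⊛-X· (÷X f ⊛ inv1 η) (η ⊛ inv1 (÷X f)) ⟩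
        X· ((÷X f ⊛ inv1 η) ⊛ (η ⊛ inv1 (÷X f)))  ≈⟨ X·-cong (⊛-inv1-cancel-middle (÷X f) (inv1 (÷X f)) η refl) ⟩
        X· (÷X f ⊛ inv1 (÷X f))                   ≈⟨ X·-cong (inv1-inverseʳ (÷X f) (proj₂ f∈)) ⟩
        xS                                        ∎

    ∙-inverseˡ : (inverse a ∙ a) ≈Q e
    ∙-inverseˡ = g-part , quotCompose-inverse-self f₁∈ , quotCompose-inverse-self f₂∈ , quotCompose-inverse-self f₃∈
      where
      open ≋-Reasoning
      g-part : (inverseG h (g a) ⊛ compose (g a) (rootOf (inverse a))) ≋ one
      g-part = begin
        compose (inv1 (g a)) L ⊛ compose (g a) (rootOf (inverse a))
          ≈⟨ ⊛-congˡ (compose (inv1 (g a)) L) (compose-congʳ (g a) rootOf-inverse) ⟩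
        compose (inv1 (g a)) L ⊛ compose (g a) L  ≈⟨ compose-⊛ (inv1 (g a)) (g a) L L₀ ⟨
        compose (inv1 (g a) ⊛ g a) L              ≈⟨ compose-congˡ L (inv1-inverseˡ (g a) (proj₂ g∈)) ⟩
        compose one L                             ≈⟨ compose-one L ⟩
        one                                       ∎

    𝒜-inverse : g a ≋ one → inverseG h (g a) ≋ one
    𝒜-inverse g≋1 =
      ≋-trans (compose-congˡ L (inv1-unique (g a) one (proj₂ g∈) (≋-trans (⊛-identityʳ (g a)) g≋1))) (compose-one L)

    ℬ-inverse : ∀ {f} → IsF f → f ≋ X· (g a) → inverseF h f ≋ X· (inverseG h (g a))
    ℬ-inverse {f} f∈ f≋xg = begin
      compose (X· (η ⊛ inv1 (÷X f))) L
        ≈⟨ compose-congˡ L (X·-cong (⊛-congˡ η (inv1-cong (proj₂ f∈) (÷X-cong f≋xg)))) ⟩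
      compose (X· (η ⊛ inv1 (g a))) L
        ≈⟨ compose-congˡ L (≋-trans (≋-sym (X·-⊛ η (inv1 (g a)))) (⊛-congʳ (inv1 (g a)) (X·-÷X h refl))) ⟩
      compose (h ⊛ inv1 (g a)) L      ≈⟨ compose-⊛ h (inv1 (g a)) L L₀ ⟩
      compose h L ⊛ inverseG h (g a)  ≈⟨ ⊛-congʳ (inverseG h (g a)) (compose-compInverseʳ h refl refl) ⟩
      xS ⊛ inverseG h (g a)           ≈⟨ xS-⊛ (inverseG h (g a)) ⟩
      X· (inverseG h (g a))           ∎
      where open ≋-Reasoning

  closed⇒isSubgroup : (P : Quad → Set ℓ) → P e → (∀ a b → P a → P b → P (a ∙ b)) →
                      (∀ a → InTR a → P a → P (inverse a)) → IsSubgroup (λ a → InTR a × P a)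
  closed⇒isSubgroup P e∈P ∙-closed inverse-closed =
      (InTR-e , e∈P)
    , (λ a b (a∈TR , Pa) (b∈TR , Pb) → InTR-∙ {a} {b} a∈TR b∈TR , ∙-closed a b Pa Pb)
    , (λ a (a∈TR , Pa) → inverse a , (InTR-inverse {a} a∈TR , inverse-closed a a∈TR Pa)
                                   , ∙-inverseʳ {a} a∈TR , ∙-inverseˡ {a} a∈TR)

  𝒜-isSubgroup : IsSubgroup 𝒜
  𝒜-isSubgroup = closed⇒isSubgroup (λ a → g a ≋ one) ≋-refl
    (λ a b → 𝒜-∙ (rootOf a)) (λ a a∈TR → 𝒜-inverse a∈TR)

  ℬ₁-isSubgroup : IsSubgroup ℬ₁
  ℬ₁-isSubgroup = closed⇒isSubgroup (λ a → f₁ a ≋ X· (g a)) ≋-refl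
    (λ a b → ℬ-∙ (rootOf a) refl refl) (λ a a∈TR → ℬ-inverse a∈TR (proj₁ (proj₂ a∈TR)))

  ℬ₂-isSubgroup : IsSubgroup ℬ₂
  ℬ₂-isSubgroup = closed⇒isSubgroup (λ a → f₂ a ≋ X· (g a)) ≋-refl
    (λ a b → ℬ-∙ (rootOf a) refl refl) (λ a a∈TR → ℬ-inverse a∈TR (proj₁ (proj₂ (proj₂ a∈TR))))

  ℬ₃-isSubgroup : IsSubgroup ℬ₃
  ℬ₃-isSubgroup = closed⇒isSubgroup (λ a → f₃ a ≋ X· (g a)) ≋-refl
    (λ a b → ℬ-∙ (rootOf a) refl refl) (λ a a∈TR → ℬ-inverse a∈TR (proj₂ (proj₂ (proj₂ a∈TR))))

mainTheorem4 : ∀ {c ℓ} (R : CommutativeRing c ℓ) (Q : Containsℚ R) →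
    let open TripleRiordan R Q in
    IsSubgroup 𝒜 × IsSubgroup ℬ₁ × IsSubgroup ℬ₂ × IsSubgroup ℬ₃
mainTheorem4 R Q = 𝒜-isSubgroup , ℬ₁-isSubgroup , ℬ₂-isSubgroup , ℬ₃-isSubgroup
  where open TripleRiordanGroup R Q
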